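{- Let $L,R$ be nonempty subsets of a group $G$ and let $S$ be a set of double coset representatives for $G$ modulo $\langle L\rangle$ and $\langle R\rangle$ (i.e., $G$ is the disjoint union of the double cosets $\langle L\rangle s\langle R\rangle$, $s\in S$). Then the number of weakly connected components of $2\mathrm{S}(G;L,R)$ is $\sum_{s\in S}k_s$, where $k_s$ is the minimum weak connection length in $\langle L\rangle s\langle R\rangle$.
   Context: For a group $G$ and nonempty subsets $L,R\subseteq G$, the two-sided group digraph $2\mathrm{S}(G;L,R)$ has vertex set $G$ and a directed arc $(g,h)$ if and only if $h=l^{ -1}gr$ for some $l\in L$, $r\in R$. Write $g\sim h$ if there is a sequence $g=g_0,\dots,g_n=h$ such that for each $i$ either $(g_{i-1},g_i)$ or $(g_i,g_{i-1})$ is an arc; weakly connected components are the classes of $\sim$. A word in a set $X$ of length $n>0$ is a product $x_1\cdots x_n$ with all $x_i\in X$; $L^{ -1}=\{l^{ -1}:l\in L\}$; $\langle X\rangle$ is the subgroup generated by $X$. The minimum weak connection length in $\langle L\rangle s\langle R\rangle$ is the minimum length $k_s\ge1$ of a word $w$ purely in $L$ or purely in $L^{ -1}$ with $ws\sim s$ (equivalently, of a word $w$ purely in $R$ or purely in $R^{ -1}$ with $sw\sim s$), and is infinite if no such word exists. -}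

module Defs where

open import Level using (Level; _⊔_)
open import Algebra.Bundles using (Group)
open import Data.Nat using (ℕ; suc; _≤_)
open import Data.Fin using (Fin)
open import Data.Maybe using (Maybe; just; nothing)
open import Data.Product using (Σ; ∃; ∃-syntax; _×_; _,_)
open import Data.Sum using (_⊎_)
open import Relation.Nullary using (¬_)
open import Relation.Unary using (Pred)
open import Relation.Binary.PropositionalEquality using (_≡_)
open import Relation.Binary.Construct.Closure.Equivalence using (EqClosure)

-- Two-sided group digraph 2S(G;L,R) on a group G (a setoid-based group:
-- vertices are elements up to the group's equality ≈).
module TwoSided {c ℓ p : Level} (G : Group c ℓ) (L R : Pred (Group.Carrier G) p) where
  open Group G

  Arc : Carrier → Carrier → Set (c ⊔ ℓ ⊔ p)
  Arc g h = ∃[ l ] ∃[ r ] (L l × R r × h ≈ (l ⁻¹ ∙ g) ∙ r)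

  -- weak connectivity: equivalence closure of arcs (and of the group's equality)
  Step : Carrier → Carrier → Set (c ⊔ ℓ ⊔ p)
  Step g h = (g ≈ h) ⊎ Arc g h

  _∼_ : Carrier → Carrier → Set (c ⊔ ℓ ⊔ p)
  _∼_ = EqClosure Step

  Inv : Pred Carrier p → Pred Carrier (c ⊔ ℓ ⊔ p)
  Inv X y = ∃[ x ] (X x × y ≈ x ⁻¹)

  data Word {q : Level} (X : Pred Carrier q) : ℕ → Carrier → Set (c ⊔ q) where
    [_] : ∀ {x} → X x → Word X 1 x
    _∷_ : ∀ {x n w} → X x → Word X n w → Word X (suc n) (x ∙ w)

  data ⟨_⟩ {q : Level} (X : Pred Carrier q) : Pred Carrier (c ⊔ ℓ ⊔ q) where
    gen-ε   : ⟨ X ⟩ ε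
    gen-∙   : ∀ {x y} → X x → ⟨ X ⟩ y → ⟨ X ⟩ (x ∙ y)
    gen-⁻¹∙ : ∀ {x y} → X x → ⟨ X ⟩ y → ⟨ X ⟩ (x ⁻¹ ∙ y)
    gen-≈   : ∀ {x y} → x ≈ y → ⟨ X ⟩ x → ⟨ X ⟩ y

  InDoubleCoset : Carrier → Carrier → Set (c ⊔ ℓ ⊔ p)
  InDoubleCoset s g = ∃[ a ] ∃[ b ] (⟨ L ⟩ a × ⟨ R ⟩ b × g ≈ (a ∙ s) ∙ b)

  ConnectsAt : Carrier → ℕ → Set (c ⊔ ℓ ⊔ p)
  ConnectsAt s n = ∃[ w ] ((Word L n w ⊎ Word (Inv L) n w) × ((w ∙ s) ∼ s))

  -- k is the minimum weak connection length in ⟨L⟩ s ⟨R⟩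
  -- (just k = finite value k, nothing = infinite)
  IsMinConnLength : Carrier → Maybe ℕ → Set (c ⊔ ℓ ⊔ p)
  IsMinConnLength s (just k) = ConnectsAt s k × (∀ m → ConnectsAt s m → k ≤ m)
  IsMinConnLength s nothing  = ∀ m → ¬ ConnectsAt s m

-- the cardinal k_s as a type: Fin k for finite k, ℕ (countably infinite) for ∞
Card : Maybe ℕ → Set
Card (just k) = Fin k
Card nothing  = ℕ

module Submission where

-- Fix l₀ ∈ L and r₀ ∈ R.  The arc g → l⁻¹ g r gives  l x ∼ x r  for all
-- l ∈ L, r ∈ R, so every l ∈ L and every r ∈ R (multiplying on the right)
-- moves components exactly like left multiplication by l₀, and left
-- multiplication by any element of ⟨L⟩ maps components to components.
-- Components never leave a double coset, because arcs do not.  Inside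
-- ⟨L⟩ t ⟨R⟩ every element is therefore connected to some l₀ᶻ t (z ∈ ℤ), and
--   * if k = k_t is finite, l₀⁻ᵏ t ∼ t and the l₀⁻ⁱ t with i < k are pairwise
--     disconnected (a connection would be a shorter connecting word);
--   * if k = ∞, the l₀ᶻ t (z ∈ ℤ) are pairwise disconnected.
-- So each double coset contributes exactly k_t components, indexed by Card k_t.

open import Defs
open import Level using (Level; _⊔_)
open import Algebra.Bundles using (Group)
open import Data.Maybe using (Maybe; just; nothing)
open import Data.Nat using (ℕ; zero; suc; _+_; _≤_; _<_; z≤n; s≤s)
open import Data.Nat.Properties
  using (+-suc; suc-injective; <-cmp; <-irrefl; ≤-<-trans; <⇒≤; n<1+n; m≤n+m; m≤n⇒m<n∨m≡n; m≤n⇒∃[o]m+o≡n)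
open import Data.Integer.Base using (ℤ; +_; -[1+_])
open import Data.Fin using (toℕ; fromℕ<)
open import Data.Fin.Properties using (toℕ-injective; toℕ<n; toℕ-fromℕ<)
open import Data.Product using (Σ; ∃-syntax; _×_; _,_)
open import Data.Sum using (inj₁; inj₂)
open import Data.Empty using (⊥-elim)
open import Relation.Nullary using (¬_)
open import Relation.Unary using (Pred)
open import Relation.Binary.Bundles using (Preorder)
open import Relation.Binary.Definitions using (tri<; tri≈; tri>)
open import Relation.Binary.Structures using (IsEquivalence)
open import Relation.Binary.PropositionalEquality using (_≡_)
import Relation.Binary.PropositionalEquality as ≡
import Relation.Binary.Construct.Closure.Equivalence as EqClosure
open import Relation.Binary.Construct.Closure.ReflexiveTransitive using (_◅◅_)
import Relation.Binary.Reasoning.Setoid as SetoidReasoning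
import Relation.Binary.Reasoning.Preorder as PreorderReasoning
import Algebra.Properties.Group as GroupProperties
import Algebra.Properties.Monoid.Mult as MonoidMult
open import Tactic.MonoidSolver using (solve)

no-ascent⇒≡ : ∀ {r} {_R_ : ℕ → ℕ → Set r} →
              (∀ {a b} → a R b → b R a) → (∀ {a b} → a < b → ¬ (a R b)) →
              ∀ {a b} → a R b → a ≡ b
no-ascent⇒≡ R-sym no-ascent {a} {b} aRb with <-cmp a b
... | tri< a<b _ _ = ⊥-elim (no-ascent a<b aRb)
... | tri≈ _ a≡b _ = a≡b
... | tri> _ _ b<a = ⊥-elim (no-ascent b<a (R-sym aRb))

<⇒+suc : ∀ {a b} → a < b → ∃[ d ] (a + suc d ≡ b)
<⇒+suc {a} a<b with m≤n⇒∃[o]m+o≡n a<b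
... | d , suc-a+d≡b = d , ≡.trans (+-suc a d) suc-a+d≡b

-- The components of a double coset with infinite k_s are indexed by ℤ, while
-- the statement indexes them by Card nothing = ℕ.
next : ℤ → ℤ
next (+ m)    = -[1+ m ]
next -[1+ m ] = + suc m

zigzag : ℕ → ℤ
zigzag zero    = + 0
zigzag (suc n) = next (zigzag n)

index : ℤ → ℕ
index (+ m)    = m + m
index -[1+ m ] = suc (m + m)

index-zigzag : ∀ n → index (zigzag n) ≡ n
index-zigzag zero    = ≡.refl
index-zigzag (suc n) = ≡.trans (index-next (zigzag n)) (≡.cong suc (index-zigzag n))
  where
  index-next : ∀ z → index (next z) ≡ suc (index z)
  index-next (+ m)    = ≡.refl
  index-next -[1+ m ] = ≡.cong suc (+-suc m m)

zigzag-injective : ∀ {m n} → zigzag m ≡ zigzag n → m ≡ n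
zigzag-injective {m} {n} eq =
  ≡.trans (≡.sym (index-zigzag m)) (≡.trans (≡.cong index eq) (index-zigzag n))

mutual
  zigzag-even : ∀ m → zigzag (m + m) ≡ + m
  zigzag-even zero    = ≡.refl
  zigzag-even (suc m) rewrite +-suc m m = ≡.cong next (zigzag-odd m)

  zigzag-odd : ∀ m → zigzag (suc (m + m)) ≡ -[1+ m ]
  zigzag-odd m = ≡.cong next (zigzag-even m)

zigzag-index : ∀ z → zigzag (index z) ≡ z
zigzag-index (+ m)    = zigzag-even m
zigzag-index -[1+ m ] = zigzag-odd m

module Powers {c ℓ : Level} (G : Group c ℓ) where
  open Group G
  open GroupProperties G using (\\-leftDividesˡ; \\-leftDividesʳ)
  open MonoidMult monoid using (×-homo-+) renaming (_×_ to _times_)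
  open SetoidReasoning setoid

  pow : ℕ → Carrier → Carrier
  pow n x = n times x

  zpow : ℤ → Carrier → Carrier
  zpow (+ n)    x = pow n x
  zpow -[1+ n ] x = pow (suc n) (x ⁻¹)

  pow-+-∙ : ∀ x m n y → pow (m + n) x ∙ y ≈ pow m x ∙ (pow n x ∙ y)
  pow-+-∙ x m n y = trans (∙-congʳ (×-homo-+ x m n)) (assoc _ _ _)

  pow-sucʳ : ∀ x n → pow (suc n) x ≈ pow n x ∙ x
  pow-sucʳ x zero    = trans (identityʳ x) (sym (identityˡ x))
  pow-sucʳ x (suc n) = trans (∙-congˡ (pow-sucʳ x n)) (sym (assoc _ _ _))

  pow-cancel : ∀ {x y} → x ∙ y ≈ ε → ∀ n z → pow n x ∙ (pow n y ∙ z) ≈ z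
  pow-cancel xy≈ε zero    z = trans (identityˡ _) (identityˡ z)
  pow-cancel {x} {y} xy≈ε (suc n) z = begin
    (x ∙ pow n x) ∙ (pow (suc n) y ∙ z)  ≈⟨ ∙-congˡ (∙-congʳ (pow-sucʳ y n)) ⟩
    (x ∙ pow n x) ∙ ((pow n y ∙ y) ∙ z)  ≈⟨ solve monoid ⟩
    x ∙ (pow n x ∙ (pow n y ∙ (y ∙ z)))  ≈⟨ ∙-congˡ (pow-cancel xy≈ε n (y ∙ z)) ⟩
    x ∙ (y ∙ z)                          ≈⟨ assoc x y z ⟨
    (x ∙ y) ∙ z                          ≈⟨ ∙-congʳ xy≈ε ⟩
    ε ∙ z                                ≈⟨ identityˡ z ⟩
    z                                    ∎

  cancel-inner : ∀ a q y → a ∙ ((a ⁻¹ ∙ q) ∙ y) ≈ q ∙ y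
  cancel-inner a q y = trans (∙-congˡ (assoc _ _ _)) (\\-leftDividesˡ a (q ∙ y))

  cancel-inner⁻¹ : ∀ a q y → a ⁻¹ ∙ ((a ∙ q) ∙ y) ≈ q ∙ y
  cancel-inner⁻¹ a q y = trans (∙-congˡ (assoc _ _ _)) (\\-leftDividesʳ a (q ∙ y))

module TwoSidedFacts {c ℓ p : Level} (G : Group c ℓ) (L R : Pred (Group.Carrier G) p) where
  open Group G
  open GroupProperties G using (ε⁻¹≈ε; ⁻¹-anti-homo-∙; ⁻¹-involutive; \\-leftDividesʳ; //-rightDividesʳ)
  open TwoSided G L R
  open Powers G
  open SetoidReasoning setoid

  module _ {q : Level} {X : Pred Carrier q} where

    ⟨⟩-∙ : ∀ {a b} → ⟨ X ⟩ a → ⟨ X ⟩ b → ⟨ X ⟩ (a ∙ b)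
    ⟨⟩-∙ gen-ε            b∈ = gen-≈ (sym (identityˡ _)) b∈
    ⟨⟩-∙ (gen-∙ x∈ a∈)    b∈ = gen-≈ (sym (assoc _ _ _)) (gen-∙ x∈ (⟨⟩-∙ a∈ b∈))
    ⟨⟩-∙ (gen-⁻¹∙ x∈ a∈)  b∈ = gen-≈ (sym (assoc _ _ _)) (gen-⁻¹∙ x∈ (⟨⟩-∙ a∈ b∈))
    ⟨⟩-∙ (gen-≈ a≈a′ a∈)  b∈ = gen-≈ (∙-congʳ a≈a′) (⟨⟩-∙ a∈ b∈)

    ⟨⟩-gen : ∀ {x} → X x → ⟨ X ⟩ x
    ⟨⟩-gen x∈ = gen-≈ (identityʳ _) (gen-∙ x∈ gen-ε)

    ⟨⟩-gen⁻¹ : ∀ {x} → X x → ⟨ X ⟩ (x ⁻¹)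
    ⟨⟩-gen⁻¹ x∈ = gen-≈ (identityʳ _) (gen-⁻¹∙ x∈ gen-ε)

    ⟨⟩-⁻¹ : ∀ {a} → ⟨ X ⟩ a → ⟨ X ⟩ (a ⁻¹)
    ⟨⟩-⁻¹ gen-ε = gen-≈ (sym ε⁻¹≈ε) gen-ε
    ⟨⟩-⁻¹ (gen-∙ {x} {y} x∈ y∈) =
      gen-≈ (sym (⁻¹-anti-homo-∙ x y)) (⟨⟩-∙ (⟨⟩-⁻¹ y∈) (⟨⟩-gen⁻¹ x∈))
    ⟨⟩-⁻¹ (gen-⁻¹∙ {x} {y} x∈ y∈) =
      gen-≈ (sym (trans (⁻¹-anti-homo-∙ (x ⁻¹) y) (∙-congˡ (⁻¹-involutive x))))
            (⟨⟩-∙ (⟨⟩-⁻¹ y∈) (⟨⟩-gen x∈))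
    ⟨⟩-⁻¹ (gen-≈ a≈a′ a∈) = gen-≈ (⁻¹-cong a≈a′) (⟨⟩-⁻¹ a∈)

    ⟨⟩-pow : ∀ {a} n → ⟨ X ⟩ a → ⟨ X ⟩ (pow n a)
    ⟨⟩-pow zero    a∈ = gen-ε
    ⟨⟩-pow (suc n) a∈ = ⟨⟩-∙ a∈ (⟨⟩-pow n a∈)

    ⟨⟩-zpow : ∀ {a} z → ⟨ X ⟩ a → ⟨ X ⟩ (zpow z a)
    ⟨⟩-zpow (+ n)    a∈ = ⟨⟩-pow n a∈
    ⟨⟩-zpow -[1+ n ] a∈ = ⟨⟩-pow (suc n) (⟨⟩-⁻¹ a∈)

    power-word : ∀ {u} → X u → ∀ d → ∃[ w ] (Word X (suc d) w × w ≈ pow (suc d) u)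
    power-word u∈ zero    = _ , [ u∈ ] , sym (identityʳ _)
    power-word u∈ (suc d) with power-word u∈ d
    ... | w , w-word , w≈ = _ , u∈ ∷ w-word , ∙-congˡ w≈

  coset-refl : ∀ {s} → InDoubleCoset s s
  coset-refl = ε , ε , gen-ε , gen-ε , sym (trans (identityʳ _) (identityˡ _))

  coset-sym : ∀ {s g} → InDoubleCoset s g → InDoubleCoset g s
  coset-sym {s} {g} (a , b , a∈ , b∈ , g≈) = a ⁻¹ , b ⁻¹ , ⟨⟩-⁻¹ a∈ , ⟨⟩-⁻¹ b∈ , (begin
    s                              ≈⟨ //-rightDividesʳ b s ⟨
    (s ∙ b) ∙ b ⁻¹                 ≈⟨ ∙-congʳ (\\-leftDividesʳ a (s ∙ b)) ⟨
    (a ⁻¹ ∙ (a ∙ (s ∙ b))) ∙ b ⁻¹  ≈⟨ solve monoid ⟩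
    (a ⁻¹ ∙ ((a ∙ s) ∙ b)) ∙ b ⁻¹  ≈⟨ ∙-congʳ (∙-congˡ g≈) ⟨
    (a ⁻¹ ∙ g) ∙ b ⁻¹              ∎)

  coset-trans : ∀ {s g h} → InDoubleCoset s g → InDoubleCoset g h → InDoubleCoset s h
  coset-trans {s} {g} {h} (a , b , a∈ , b∈ , g≈) (a′ , b′ , a′∈ , b′∈ , h≈) =
    a′ ∙ a , b ∙ b′ , ⟨⟩-∙ a′∈ a∈ , ⟨⟩-∙ b∈ b′∈ , (begin
      h                          ≈⟨ h≈ ⟩
      (a′ ∙ g) ∙ b′              ≈⟨ ∙-congʳ (∙-congˡ g≈) ⟩
      (a′ ∙ ((a ∙ s) ∙ b)) ∙ b′  ≈⟨ solve monoid ⟩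
      ((a′ ∙ a) ∙ s) ∙ (b ∙ b′)  ∎)

  coset-isEquivalence : IsEquivalence InDoubleCoset
  coset-isEquivalence = record { refl = coset-refl ; sym = coset-sym ; trans = coset-trans }

  -- An arc g → l⁻¹ g r stays inside the double coset of g, hence so does
  -- every weakly connected component.
  ∼⇒coset : ∀ {g h} → g ∼ h → InDoubleCoset g h
  ∼⇒coset = EqClosure.fold coset-isEquivalence step⇒coset
    where
    step⇒coset : ∀ {g h} → Step g h → InDoubleCoset g h
    step⇒coset (inj₁ g≈h) = ε , ε , gen-ε , gen-ε , trans (sym g≈h) (sym (trans (identityʳ _) (identityˡ _)))
    step⇒coset (inj₂ (l , r , l∈ , r∈ , h≈)) = l ⁻¹ , r , ⟨⟩-gen⁻¹ l∈ , ⟨⟩-gen r∈ , h≈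

  no-empty-connection : ∀ {s} → ¬ ConnectsAt s 0
  no-empty-connection (_ , inj₁ () , _)
  no-empty-connection (_ , inj₂ () , _)

module Components {c ℓ p : Level} (G : Group c ℓ) (L R : Pred (Group.Carrier G) p)
                  {l₀ r₀ : Group.Carrier G} (l₀∈L : L l₀) (r₀∈R : R r₀) where
  open Group G
  open GroupProperties G using (\\-leftDividesʳ; //-rightDividesˡ; //-rightDividesʳ)
  open TwoSided G L R
  open Powers G
  open TwoSidedFacts G L R

  ∼-sym : ∀ {x y} → x ∼ y → y ∼ x
  ∼-sym = EqClosure.symmetric Step

  ≈⇒∼ : ∀ {x y} → x ≈ y → x ∼ y
  ≈⇒∼ x≈y = EqClosure.return (inj₁ x≈y)

  -- ∼ is a preorder over ≈; in its reasoning chains `≲⟨_⟩` is a step along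
  -- weak connection and `≈⟨_⟩` a group equation.
  ∼-preorder : Preorder c ℓ (c ⊔ ℓ ⊔ p)
  ∼-preorder = record
    { _≈_ = _≈_ ; _≲_ = _∼_
    ; isPreorder = record { isEquivalence = isEquivalence ; reflexive = ≈⇒∼ ; trans = _◅◅_ } }

  open PreorderReasoning ∼-preorder

  arc : ∀ {l r x} → L l → R r → x ∼ ((l ⁻¹ ∙ x) ∙ r)
  arc l∈ r∈ = EqClosure.return (inj₂ (_ , _ , l∈ , r∈ , refl))

  swap : ∀ {l r} → L l → R r → ∀ x → (l ∙ x) ∼ (x ∙ r)
  swap {l} {r} l∈ r∈ x = begin
    l ∙ x                 ≲⟨ arc l∈ r∈ ⟩
    (l ⁻¹ ∙ (l ∙ x)) ∙ r  ≈⟨ ∙-congʳ (\\-leftDividesʳ l x) ⟩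
    x ∙ r                 ∎

  swap⁻¹ : ∀ {l r} → L l → R r → ∀ x → (x ∙ r ⁻¹) ∼ (l ⁻¹ ∙ x)
  swap⁻¹ {l} {r} l∈ r∈ x = begin
    x ∙ r ⁻¹                 ≲⟨ arc l∈ r∈ ⟩
    (l ⁻¹ ∙ (x ∙ r ⁻¹)) ∙ r  ≈⟨ solve monoid ⟩
    l ⁻¹ ∙ ((x ∙ r ⁻¹) ∙ r)  ≈⟨ ∙-congˡ (//-rightDividesˡ r x) ⟩
    l ⁻¹ ∙ x                 ∎

  L-acts-as-l₀ : ∀ {l} → L l → ∀ x → (l ∙ x) ∼ (l₀ ∙ x)
  L-acts-as-l₀ l∈ x = swap l∈ r₀∈R x ◅◅ ∼-sym (swap l₀∈L r₀∈R x)

  L⁻¹-acts-as-l₀⁻¹ : ∀ {l} → L l → ∀ x → (l ⁻¹ ∙ x) ∼ (l₀ ⁻¹ ∙ x)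
  L⁻¹-acts-as-l₀⁻¹ l∈ x = ∼-sym (swap⁻¹ l∈ r₀∈R x) ◅◅ swap⁻¹ l₀∈L r₀∈R x

  R-acts-as-l₀ : ∀ {r} → R r → ∀ x → (x ∙ r) ∼ (l₀ ∙ x)
  R-acts-as-l₀ r∈ x = ∼-sym (swap l₀∈L r∈ x)

  R⁻¹-acts-as-l₀⁻¹ : ∀ {r} → R r → ∀ x → (x ∙ r ⁻¹) ∼ (l₀ ⁻¹ ∙ x)
  R⁻¹-acts-as-l₀⁻¹ r∈ x = swap⁻¹ l₀∈L r∈ x

  LeftInvariant : Carrier → Set (c ⊔ ℓ ⊔ p)
  LeftInvariant u = ∀ {x y} → x ∼ y → (u ∙ x) ∼ (u ∙ y)

  stepwise : ∀ {u} → (∀ {x y} → Step x y → (u ∙ x) ∼ (u ∙ y)) → LeftInvariant u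
  stepwise {u} step = EqClosure.gfold (EqClosure.isEquivalence Step) (u ∙_) step

  L-leftInvariant : ∀ {l} → L l → LeftInvariant l
  L-leftInvariant {l} l∈ = stepwise step
    where
    step : ∀ {x y} → Step x y → (l ∙ x) ∼ (l ∙ y)
    step (inj₁ x≈y) = ≈⇒∼ (∙-congˡ x≈y)
    step {x} {y} (inj₂ (a , b , a∈ , b∈ , y≈)) = begin
      l ∙ x                 ≲⟨ swap l∈ b∈ x ⟩
      x ∙ b                 ≲⟨ arc a∈ b∈ ⟩
      (a ⁻¹ ∙ (x ∙ b)) ∙ b  ≈⟨ ∙-congʳ (trans (sym (assoc _ _ _)) (sym y≈)) ⟩
      y ∙ b                 ≲⟨ ∼-sym (swap l∈ b∈ y) ⟩
      l ∙ y                 ∎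

  L⁻¹-leftInvariant : ∀ {l} → L l → LeftInvariant (l ⁻¹)
  L⁻¹-leftInvariant {l} l∈ = stepwise step
    where
    step : ∀ {x y} → Step x y → (l ⁻¹ ∙ x) ∼ (l ⁻¹ ∙ y)
    step (inj₁ x≈y) = ≈⇒∼ (∙-congˡ x≈y)
    step {x} {y} (inj₂ (a , b , a∈ , b∈ , y≈)) = begin
      l ⁻¹ ∙ x    ≲⟨ ∼-sym (swap⁻¹ l∈ b∈ x) ⟩
      x ∙ b ⁻¹    ≲⟨ swap⁻¹ a∈ b∈ x ⟩
      a ⁻¹ ∙ x    ≈⟨ //-rightDividesʳ b (a ⁻¹ ∙ x) ⟨
      ((a ⁻¹ ∙ x) ∙ b) ∙ b ⁻¹  ≈⟨ ∙-congʳ y≈ ⟨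
      y ∙ b ⁻¹    ≲⟨ swap⁻¹ l∈ b∈ y ⟩
      l ⁻¹ ∙ y    ∎

  ⟨L⟩-leftInvariant : ∀ {u} → ⟨ L ⟩ u → LeftInvariant u
  ⟨L⟩-leftInvariant gen-ε x∼y =
    ≈⇒∼ (identityˡ _) ◅◅ x∼y ◅◅ ≈⇒∼ (sym (identityˡ _))
  ⟨L⟩-leftInvariant (gen-∙ l∈ u∈) x∼y =
    ≈⇒∼ (assoc _ _ _) ◅◅ L-leftInvariant l∈ (⟨L⟩-leftInvariant u∈ x∼y) ◅◅ ≈⇒∼ (sym (assoc _ _ _))
  ⟨L⟩-leftInvariant (gen-⁻¹∙ l∈ u∈) x∼y =
    ≈⇒∼ (assoc _ _ _) ◅◅ L⁻¹-leftInvariant l∈ (⟨L⟩-leftInvariant u∈ x∼y) ◅◅ ≈⇒∼ (sym (assoc _ _ _))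
  ⟨L⟩-leftInvariant (gen-≈ u≈u′ u∈) x∼y =
    ≈⇒∼ (∙-congʳ (sym u≈u′)) ◅◅ ⟨L⟩-leftInvariant u∈ x∼y ◅◅ ≈⇒∼ (∙-congʳ u≈u′)

  record Saturated {q : Level} (P : Pred Carrier q) : Set (c ⊔ ℓ ⊔ p ⊔ q) where
    field
      resp : ∀ {x y} → x ∼ y → P x → P y
      up   : ∀ {x} → P x → P (l₀ ∙ x)
      down : ∀ {x} → P x → P (l₀ ⁻¹ ∙ x)

  -- A saturated property holding at t holds on all of ⟨L⟩ t ⟨R⟩, because
  -- generators of ⟨L⟩ and ⟨R⟩ act like l₀ or l₀⁻¹.
  saturate : ∀ {q} {P : Pred Carrier q} → Saturated P → ∀ {t g} → P t → InDoubleCoset t g → P g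
  saturate {P = P} sat Pt (a , b , a∈ , b∈ , g≈) = resp (≈⇒∼ (sym g≈)) (right b∈ (left a∈ Pt))
    where
    open Saturated sat

    left : ∀ {a x} → ⟨ L ⟩ a → P x → P (a ∙ x)
    left gen-ε Px = resp (≈⇒∼ (sym (identityˡ _))) Px
    left (gen-∙ l∈ a∈) Px =
      resp (∼-sym (L-acts-as-l₀ l∈ _) ◅◅ ≈⇒∼ (sym (assoc _ _ _))) (up (left a∈ Px))
    left (gen-⁻¹∙ l∈ a∈) Px =
      resp (∼-sym (L⁻¹-acts-as-l₀⁻¹ l∈ _) ◅◅ ≈⇒∼ (sym (assoc _ _ _))) (down (left a∈ Px))
    left (gen-≈ a≈a′ a∈) Px = resp (≈⇒∼ (∙-congʳ a≈a′)) (left a∈ Px)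

    right : ∀ {b x} → ⟨ R ⟩ b → P x → P (x ∙ b)
    right gen-ε Px = resp (≈⇒∼ (sym (identityʳ _))) Px
    right (gen-∙ r∈ b∈) Px =
      resp (≈⇒∼ (assoc _ _ _)) (right b∈ (resp (∼-sym (R-acts-as-l₀ r∈ _)) (up Px)))
    right (gen-⁻¹∙ r∈ b∈) Px =
      resp (≈⇒∼ (assoc _ _ _)) (right b∈ (resp (∼-sym (R⁻¹-acts-as-l₀⁻¹ r∈ _)) (down Px)))
    right (gen-≈ b≈b′ b∈) Px = resp (≈⇒∼ (∙-congˡ b≈b′)) (right b∈ Px)

  word-acts : ∀ {q} {X : Pred Carrier q} {a} → (∀ {x} → X x → ∀ y → (x ∙ y) ∼ (a ∙ y)) →
              LeftInvariant a → ∀ {n w} → Word X n w → ∀ y → (w ∙ y) ∼ (pow n a ∙ y)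
  word-acts acts a-inv [ x∈ ] y = acts x∈ y ◅◅ ≈⇒∼ (∙-congʳ (sym (identityʳ _)))
  word-acts acts a-inv (x∈ ∷ w-word) y =
    ≈⇒∼ (assoc _ _ _) ◅◅ acts x∈ _ ◅◅ a-inv (word-acts acts a-inv w-word y) ◅◅ ≈⇒∼ (sym (assoc _ _ _))

  connects⁺ : ∀ {t} d → (pow (suc d) l₀ ∙ t) ∼ t → ConnectsAt t (suc d)
  connects⁺ d h with power-word l₀∈L d
  ... | w , w-word , w≈ = w , inj₁ w-word , ≈⇒∼ (∙-congʳ w≈) ◅◅ h

  connects⁻ : ∀ {t} d → (pow (suc d) (l₀ ⁻¹) ∙ t) ∼ t → ConnectsAt t (suc d)
  connects⁻ d h with power-word {X = Inv L} (l₀ , l₀∈L , refl) d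
  ... | w , w-word , w≈ = w , inj₂ w-word , ≈⇒∼ (∙-congʳ w≈) ◅◅ h

  period : ∀ {t n} → ConnectsAt t n → (pow n (l₀ ⁻¹) ∙ t) ∼ t
  period {t} {n} (w , inj₁ w-word , h) = begin
    pow n (l₀ ⁻¹) ∙ t                      ≲⟨ ⟨L⟩-leftInvariant l₀⁻ⁿ∈ (∼-sym positive-period) ⟩
    pow n (l₀ ⁻¹) ∙ (pow n l₀ ∙ t)         ≈⟨ pow-cancel (inverseˡ l₀) n t ⟩
    t                                      ∎
    where
    l₀⁻ⁿ∈ : ⟨ L ⟩ (pow n (l₀ ⁻¹))
    l₀⁻ⁿ∈ = ⟨⟩-pow n (⟨⟩-gen⁻¹ l₀∈L)
    positive-period : (pow n l₀ ∙ t) ∼ t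
    positive-period = ∼-sym (word-acts L-acts-as-l₀ (L-leftInvariant l₀∈L) w-word t) ◅◅ h
  period {t} (w , inj₂ w-word , h) = ∼-sym (word-acts inverse-acts (L⁻¹-leftInvariant l₀∈L) w-word t) ◅◅ h
    where
    inverse-acts : ∀ {x} → Inv L x → ∀ y → (x ∙ y) ∼ (l₀ ⁻¹ ∙ y)
    inverse-acts (l , l∈ , x≈) y = ≈⇒∼ (∙-congʳ x≈) ◅◅ L⁻¹-acts-as-l₀⁻¹ l∈ y

  power-gap : ∀ {u t a b} → ⟨ L ⟩ u → a < b → (pow a u ∙ t) ∼ (pow b u ∙ t) →
              ∃[ d ] (suc d ≤ b × (pow (suc d) u ∙ t) ∼ t)
  power-gap {u} {t} {a} u∈ a<b h with <⇒+suc a<b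
  ... | d , ≡.refl = d , m≤n+m (suc d) a , (begin
    pow (suc d) u ∙ t                              ≈⟨ pow-cancel (inverseˡ u) a _ ⟨
    pow a (u ⁻¹) ∙ (pow a u ∙ (pow (suc d) u ∙ t)) ≈⟨ ∙-congˡ (pow-+-∙ u a (suc d) t) ⟨
    pow a (u ⁻¹) ∙ (pow (a + suc d) u ∙ t)         ≲⟨ ⟨L⟩-leftInvariant (⟨⟩-pow a (⟨⟩-⁻¹ u∈)) (∼-sym h) ⟩
    pow a (u ⁻¹) ∙ (pow a u ∙ t)                   ≈⟨ pow-cancel (inverseˡ u) a t ⟩
    t                                              ∎)

  opposite-gap : ∀ {t a b} → (pow a l₀ ∙ t) ∼ (pow (suc b) (l₀ ⁻¹) ∙ t) → (pow (suc b + a) l₀ ∙ t) ∼ t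
  opposite-gap {t} {a} {b} h = begin
    pow (suc b + a) l₀ ∙ t                         ≈⟨ pow-+-∙ l₀ (suc b) a t ⟩
    pow (suc b) l₀ ∙ (pow a l₀ ∙ t)                ≲⟨ ⟨L⟩-leftInvariant (⟨⟩-pow (suc b) (⟨⟩-gen l₀∈L)) h ⟩
    pow (suc b) l₀ ∙ (pow (suc b) (l₀ ⁻¹) ∙ t)     ≈⟨ pow-cancel (inverseʳ l₀) (suc b) t ⟩
    t                                              ∎

  -- Finite case: if l₀⁻⁽ᵏ⁺¹⁾ t ∼ t, every element of ⟨L⟩ t ⟨R⟩ is connected
  -- to some l₀⁻ⁱ t with i ≤ k, since this property is saturated.
  cover-periodic : ∀ {t g} k → (pow (suc k) (l₀ ⁻¹) ∙ t) ∼ t → InDoubleCoset t g →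
                   ∃[ i ] (i < suc k × g ∼ (pow i (l₀ ⁻¹) ∙ t))
  cover-periodic {t} k per = saturate saturated (0 , s≤s z≤n , ≈⇒∼ (sym (identityˡ t)))
    where
    P : Pred Carrier (c ⊔ ℓ ⊔ p)
    P x = ∃[ i ] (i < suc k × x ∼ (pow i (l₀ ⁻¹) ∙ t))

    up : ∀ {x} → P x → P (l₀ ∙ x)
    up {x} (zero , _ , h) = k , n<1+n k , (begin
      l₀ ∙ x                                   ≲⟨ L-leftInvariant l₀∈L (h ◅◅ ≈⇒∼ (identityˡ t) ◅◅ ∼-sym per) ⟩
      l₀ ∙ ((l₀ ⁻¹ ∙ pow k (l₀ ⁻¹)) ∙ t)       ≈⟨ cancel-inner l₀ _ t ⟩
      pow k (l₀ ⁻¹) ∙ t                        ∎)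
    up (suc i , i<k+1 , h) = i , <⇒≤ i<k+1 ,
      L-leftInvariant l₀∈L h ◅◅ ≈⇒∼ (cancel-inner l₀ _ t)

    down : ∀ {x} → P x → P (l₀ ⁻¹ ∙ x)
    down (i , s≤s i≤k , h) with m≤n⇒m<n∨m≡n i≤k
    ... | inj₁ i<k = suc i , s≤s i<k , L⁻¹-leftInvariant l₀∈L h ◅◅ ≈⇒∼ (sym (assoc _ _ _))
    ... | inj₂ ≡.refl = 0 , s≤s z≤n ,
      L⁻¹-leftInvariant l₀∈L h ◅◅ ≈⇒∼ (sym (assoc _ _ _)) ◅◅ per ◅◅ ≈⇒∼ (sym (identityˡ t))

    saturated : Saturated P
    saturated = record { resp = λ x∼y (i , i< , h) → i , i< , ∼-sym x∼y ◅◅ h ; up = up ; down = down }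

  cover-free : ∀ {t g} → InDoubleCoset t g → ∃[ z ] (g ∼ (zpow z l₀ ∙ t))
  cover-free {t} = saturate saturated (+ 0 , ≈⇒∼ (sym (identityˡ t)))
    where
    P : Pred Carrier (c ⊔ ℓ ⊔ p)
    P x = ∃[ z ] (x ∼ (zpow z l₀ ∙ t))

    up : ∀ {x} → P x → P (l₀ ∙ x)
    up (+ m , h)            = + suc m , L-leftInvariant l₀∈L h ◅◅ ≈⇒∼ (sym (assoc _ _ _))
    up (-[1+ zero ] , h)    = + 0 , L-leftInvariant l₀∈L h ◅◅ ≈⇒∼ (cancel-inner l₀ _ t)
    up (-[1+ suc m ] , h)   = -[1+ m ] , L-leftInvariant l₀∈L h ◅◅ ≈⇒∼ (cancel-inner l₀ _ t)

    down : ∀ {x} → P x → P (l₀ ⁻¹ ∙ x)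
    down (+ zero , h)       = -[1+ 0 ] , L⁻¹-leftInvariant l₀∈L h ◅◅ ≈⇒∼ (sym (assoc _ _ _))
    down (+ suc m , h)      = + m , L⁻¹-leftInvariant l₀∈L h ◅◅ ≈⇒∼ (cancel-inner⁻¹ l₀ _ t)
    down (-[1+ m ] , h)     = -[1+ suc m ] , L⁻¹-leftInvariant l₀∈L h ◅◅ ≈⇒∼ (sym (assoc _ _ _))

    saturated : Saturated P
    saturated = record { resp = λ x∼y (z , h) → z , ∼-sym x∼y ◅◅ h ; up = up ; down = down }

  -- Finite case: with minimal connection length K, the l₀⁻ⁱ t (i < K) are
  -- pairwise disconnected, as a connection would be shorter than K.
  separate-periodic : ∀ {t K a b} → (∀ m → ConnectsAt t m → K ≤ m) → a < K → b < K →
                      (pow a (l₀ ⁻¹) ∙ t) ∼ (pow b (l₀ ⁻¹) ∙ t) → a ≡ b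
  separate-periodic {t} {K} minimal a<K b<K h = no-ascent⇒≡ {_R_ = Linked} Linked-sym no-ascent (a<K , b<K , h)
    where
    Linked : ℕ → ℕ → Set (c ⊔ ℓ ⊔ p)
    Linked a b = a < K × b < K × (pow a (l₀ ⁻¹) ∙ t) ∼ (pow b (l₀ ⁻¹) ∙ t)

    Linked-sym : ∀ {a b} → Linked a b → Linked b a
    Linked-sym (a<K , b<K , h) = b<K , a<K , ∼-sym h

    no-ascent : ∀ {a b} → a < b → ¬ Linked a b
    no-ascent a<b (_ , b<K , h) with power-gap (⟨⟩-gen⁻¹ l₀∈L) a<b h
    ... | d , d+1≤b , per = <-irrefl ≡.refl (≤-<-trans (minimal _ (connects⁻ d per)) (≤-<-trans d+1≤b b<K))

  separate-powers : ∀ {t u} → (∀ m → ¬ ConnectsAt t m) → ⟨ L ⟩ u →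
                    (∀ d → (pow (suc d) u ∙ t) ∼ t → ConnectsAt t (suc d)) →
                    ∀ {a b} → (pow a u ∙ t) ∼ (pow b u ∙ t) → a ≡ b
  separate-powers {t} {u} none u∈ connects =
    no-ascent⇒≡ {_R_ = λ a b → (pow a u ∙ t) ∼ (pow b u ∙ t)} ∼-sym no-ascent
    where
    no-ascent : ∀ {a b} → a < b → ¬ ((pow a u ∙ t) ∼ (pow b u ∙ t))
    no-ascent a<b h with power-gap u∈ a<b h
    ... | d , _ , per = none _ (connects d per)

  -- Infinite case: the l₀ᶻ t (z ∈ ℤ) are pairwise disconnected; for z, z′ of
  -- opposite signs a connection would arise directly.
  separate-free : ∀ {t} → (∀ m → ¬ ConnectsAt t m) → ∀ z z′ →
                  (zpow z l₀ ∙ t) ∼ (zpow z′ l₀ ∙ t) → z ≡ z′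
  separate-free none (+ a) (+ b) h =
    ≡.cong +_ (separate-powers none (⟨⟩-gen l₀∈L) connects⁺ h)
  separate-free none -[1+ a ] -[1+ b ] h =
    ≡.cong -[1+_] (suc-injective (separate-powers none (⟨⟩-gen⁻¹ l₀∈L) connects⁻ h))
  separate-free none (+ a) -[1+ b ] h = ⊥-elim (none _ (connects⁺ (b + a) (opposite-gap {a = a} {b = b} h)))
  separate-free none -[1+ a ] (+ b) h = ⊥-elim (none _ (connects⁺ (a + b) (opposite-gap {a = b} {b = a} (∼-sym h))))

  -- Representatives of the components of ⟨L⟩ t ⟨R⟩, indexed by Card k_t:
  -- l₀⁻ⁱ t (i < k) if k is finite, l₀ᶻ t (z ∈ ℤ enumerated by zigzag) if k = ∞.
  representative : Carrier → (k : Maybe ℕ) → Card k → Carrier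
  representative t (just k) i = pow (toℕ i) (l₀ ⁻¹) ∙ t
  representative t nothing  n = zpow (zigzag n) l₀ ∙ t

  representative-in-coset : ∀ t k i → InDoubleCoset t (representative t k i)
  representative-in-coset t (just k) i =
    _ , ε , ⟨⟩-pow (toℕ i) (⟨⟩-gen⁻¹ l₀∈L) , gen-ε , sym (identityʳ _)
  representative-in-coset t nothing n =
    _ , ε , ⟨⟩-zpow (zigzag n) (⟨⟩-gen l₀∈L) , gen-ε , sym (identityʳ _)

  cover : ∀ {t k g} → IsMinConnLength t k → InDoubleCoset t g → ∃[ i ] (g ∼ representative t k i)
  cover {k = just zero} (conn , _) = ⊥-elim (no-empty-connection conn)
  cover {t} {just (suc k)} {g} (conn , _) g∈ with cover-periodic k (period conn) g∈
  ... | i , i<k+1 , h = fromℕ< i<k+1 , ≡.subst (λ n → g ∼ (pow n (l₀ ⁻¹) ∙ t)) (≡.sym (toℕ-fromℕ< i<k+1)) h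
  cover {t} {nothing} {g} _ g∈ with cover-free g∈
  ... | z , h = index z , ≡.subst (λ z → g ∼ (zpow z l₀ ∙ t)) (≡.sym (zigzag-index z)) h

  separate : ∀ {t k} → IsMinConnLength t k → ∀ i j → representative t k i ∼ representative t k j → i ≡ j
  separate {k = just K} (_ , minimal) i j h = toℕ-injective (separate-periodic minimal (toℕ<n i) (toℕ<n j) h)
  separate {k = nothing} none i j h = zigzag-injective (separate-free none (zigzag i) (zigzag j) h)

-- The representatives of all double cosets together meet every component
-- exactly once; this is the statement that there are Σₛ k_s components.
corollary4p6 : {c ℓ p i : Level} (G : Group c ℓ) (L R : Pred (Group.Carrier G) p) →
    let open Group G in
    let open TwoSided G L R in
    (∃[ l ] L l) → (∃[ r ] R r) →
    (I : Set i) (s : I → Carrier) →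
    (∀ g → ∃[ j ] InDoubleCoset (s j) g) →
    (∀ j j′ → InDoubleCoset (s j) (s j′) → j ≡ j′) →
    (k : I → Maybe ℕ) → (∀ j → IsMinConnLength (s j) (k j)) →
    Σ (Σ I (λ j → Card (k j)) → Carrier) λ f → ((∀ g → ∃[ x ] (g ∼ f x)) ×
            (∀ (x y : Σ I (λ j → Card (k j))) → f x ∼ f y → x ≡ y))
corollary4p6 G L R (l₀ , l₀∈L) (r₀ , r₀∈R) I s covers disjoint k minimal = f , surjective , injective
  where
  open Group G using (Carrier)
  open TwoSided G L R using (_∼_)
  open TwoSidedFacts G L R using (coset-sym; coset-trans; ∼⇒coset)
  open Components G L R l₀∈L r₀∈R using (representative; representative-in-coset; cover; separate)

  f : Σ I (λ j → Card (k j)) → Carrier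
  f (j , i) = representative (s j) (k j) i

  surjective : ∀ g → ∃[ x ] (g ∼ f x)
  surjective g with covers g
  ... | j , g∈ with cover (minimal j) g∈
  ...   | i , h = (j , i) , h

  -- connected representatives lie in the same double coset, hence have the
  -- same index j, and then coincide by separation inside that coset
  injective : ∀ x y → f x ∼ f y → x ≡ y
  injective (j , i) (j′ , i′) h
    with disjoint j j′ (coset-trans (representative-in-coset (s j) (k j) i)
                          (coset-trans (∼⇒coset h) (coset-sym (representative-in-coset (s j′) (k j′) i′))))
  ... | ≡.refl = ≡.cong (j ,_) (separate (minimal j) i i′ h)
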